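{- Let $K$ be a valued field and $d \geq 1$. For any $d+2$ points $x_1,\ldots,x_{d+2} \in K^d$, one of them is in the convex hull of the others.
   Context: $K$ is a field with a valuation $\nu$ and valuation ring $\mathcal{O} = \{x:\nu(x)\ge0\}$. For $Y \subseteq K^d$, $\operatorname{conv}(Y) = \{\sum_{i=1}^n \alpha_i y_i : n\geq 1, y_i \in Y, \alpha_i \in \mathcal{O}, \sum_i\alpha_i = 1\}$. -}

module Defs where

open import Level using (Level; _⊔_; Lift) renaming (suc to lsuc)
open import Data.Nat using (ℕ)
import Data.Nat as ℕ
open import Data.Fin using (Fin)
import Data.Fin as F
open import Data.Maybe using (Maybe; just; nothing)
open import Data.Product using (Σ; ∃; _×_; _,_)
open import Data.Sum using (_⊎_)
open import Data.Empty using (⊥)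
open import Data.Unit using (⊤)
open import Relation.Nullary using (¬_)
open import Relation.Binary.PropositionalEquality using (_≡_; _≢_)
open import Relation.Binary.Structures using (IsTotalOrder)
open import Algebra.Bundles using (CommutativeRing; AbelianGroup)

record OrderedAbelianGroup (g ℓ₁ ℓ₂ : Level) : Set (lsuc (g ⊔ ℓ₁ ⊔ ℓ₂)) where
  field
    abelianGroup : AbelianGroup g ℓ₁
  open AbelianGroup abelianGroup public
  field
    _≤_       : Carrier → Carrier → Set ℓ₂
    isTotalOrder : IsTotalOrder _≈_ _≤_
    ≤-compat  : ∀ {x y} z → x ≤ y → (x ∙ z) ≤ (y ∙ z)

-- Γ ∪ {∞}, encoded as Maybe Γ with nothing = ∞

module Extended {g ℓ₁ ℓ₂} (Γ : OrderedAbelianGroup g ℓ₁ ℓ₂) where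
  open OrderedAbelianGroup Γ

  Γ∞ : Set g
  Γ∞ = Maybe Carrier

  ∞ : Γ∞
  ∞ = nothing

  _≈∞_ : Γ∞ → Γ∞ → Set ℓ₁
  nothing ≈∞ nothing = Lift ℓ₁ ⊤
  just a  ≈∞ just b  = a ≈ b
  _       ≈∞ _       = Lift ℓ₁ ⊥

  _≤∞_ : Γ∞ → Γ∞ → Set ℓ₂
  _       ≤∞ nothing = Lift ℓ₂ ⊤
  just a  ≤∞ just b  = a ≤ b
  nothing ≤∞ just _  = Lift ℓ₂ ⊥

  _+∞_ : Γ∞ → Γ∞ → Γ∞
  just a +∞ just b = just (a ∙ b)
  _      +∞ _      = nothing

record Field (c ℓ : Level) : Set (lsuc (c ⊔ ℓ)) where
  field
    commutativeRing : CommutativeRing c ℓ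
  open CommutativeRing commutativeRing public
  field
    0≉1     : ¬ (0# ≈ 1#)
    inverse : ∀ x → ¬ (x ≈ 0#) → ∃ λ y → (x * y) ≈ 1#

record ValuedField (c ℓ g ℓ₁ ℓ₂ : Level) : Set (lsuc (c ⊔ ℓ ⊔ g ⊔ ℓ₁ ⊔ ℓ₂)) where
  field
    field'   : Field c ℓ
    Γ        : OrderedAbelianGroup g ℓ₁ ℓ₂
  open Field field' public
  open Extended Γ public
  field
    ν        : Carrier → Γ∞
    ν-cong   : ∀ {x y} → x ≈ y → ν x ≈∞ ν y
    ν-∞⇒0    : ∀ x → ν x ≡ ∞ → x ≈ 0#
    0⇒ν-∞    : ∀ x → x ≈ 0# → ν x ≡ ∞
    ν-mult   : ∀ x y → ν (x * y) ≈∞ (ν x +∞ ν y)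
    ν-ultra  : ∀ x y → (ν x ≤∞ ν (x + y)) ⊎ (ν y ≤∞ ν (x + y))

  InO : Carrier → Set ℓ₂
  InO x = just (OrderedAbelianGroup.ε Γ) ≤∞ ν x

  ∑ : ∀ {n} → (Fin n → Carrier) → Carrier
  ∑ {ℕ.zero}  f = 0#
  ∑ {ℕ.suc n} f = f F.zero + ∑ (λ k → f (F.suc k))

  Point : ℕ → Set c
  Point d = Fin d → Carrier

  InConv : ∀ {d} {p} → (Point d → Set p) → Point d → Set (c ⊔ ℓ ⊔ ℓ₂ ⊔ p)
  InConv {d} Y z =
    Σ ℕ λ n → Σ (Fin (ℕ.suc n) → Point d) λ y → Σ (Fin (ℕ.suc n) → Carrier) λ α →
      (∀ k → Y (y k)) × (∀ k → InO (α k)) × (∑ α ≈ 1#) ×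
      (∀ (j : Fin d) → z j ≈ ∑ (λ k → α k * y k j))

-- The d + 2 vectors (1, xᵢ) ∈ K^(d+1) are linearly dependent, so there is a nontrivial
-- relation ∑ λᵢ = 0, ∑ λᵢ xᵢ = 0. Choose i with ν(λᵢ) minimal; then λᵢ ≠ 0 and
-- xᵢ = ∑_{k ≠ i} (−λₖ/λᵢ) xₖ, where the coefficients sum to 1 and have valuation
-- ν(λₖ) − ν(λᵢ) ≥ 0 (using ν(−1) = 0), i.e. lie in 𝒪.
module Submission where

open import Defs
open import Level using (Level; _⊔_; lift)
open import Data.Nat using (ℕ; zero; suc; s≤s; _<_)
open import Data.Nat.Properties using (m<n⇒m<1+n; n<1+n)
import Data.Nat.Properties as ℕ
open import Data.Fin using (Fin; punchIn)
import Data.Fin as F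
open import Data.Fin.Properties using (punchInᵢ≢i; all?; ¬∀⟶∃¬)
open import Data.Vec.Functional using (Vector; replicate; insertAt; removeAt)
open import Data.Vec.Functional.Properties using (insertAt-lookup; insertAt-punchIn)
open import Data.Maybe using (just; nothing)
open import Data.Product using (∃; _×_; _,_)
open import Data.Sum using (inj₁; inj₂)
open import Function using (_∘_)
open import Relation.Nullary using (Dec; yes; no; contradiction)
open import Relation.Binary using (Rel; Reflexive; Transitive; Total)
open import Relation.Binary.Structures using (IsTotalOrder)
open import Relation.Binary.PropositionalEquality as ≡ using (_≡_; _≢_)
open import Algebra.Bundles using (CommutativeRing)

module DotProduct {c ℓ} (R : CommutativeRing c ℓ) where
  open CommutativeRing R
  open import Algebra.Properties.Semiring.Sum semiring public
  open import Algebra.Properties.Ring ring using (-‿distribˡ-*; -‿distribʳ-*)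
  open import Algebra.Properties.AbelianGroup +-abelianGroup using (inverseˡ-unique)
  open import Relation.Binary.Reasoning.Setoid setoid

  ⟨_,_⟩ : ∀ {n} → Vector Carrier n → Vector Carrier n → Carrier
  ⟨ s , t ⟩ = sum (λ j → s j * t j)

  ⟨⟩-zeroʳ : ∀ {n} (s t : Vector Carrier n) → (∀ j → t j ≈ 0#) → ⟨ s , t ⟩ ≈ 0#
  ⟨⟩-zeroʳ {n} s t t≈0 = begin
    ⟨ s , t ⟩           ≈⟨ sum-cong-≋ (λ j → trans (*-congˡ (t≈0 j)) (zeroʳ (s j))) ⟩
    sum (replicate n 0#) ≈⟨ sum-replicate-zero n ⟩
    0#                  ∎

  ⟨⟩-scaleˡ : ∀ {n} (s t : Vector Carrier n) a → ⟨ (λ j → s j * a) , t ⟩ ≈ ⟨ s , t ⟩ * a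
  ⟨⟩-scaleˡ s t a = begin
    sum (λ j → (s j * a) * t j) ≈⟨ sum-cong-≋ (λ j → *-assoc-comm (s j) a (t j)) ⟩
    sum (λ j → (s j * t j) * a) ≈⟨ *-distribʳ-sum a (λ j → s j * t j) ⟨
    ⟨ s , t ⟩ * a               ∎
    where
    *-assoc-comm : ∀ x y z → (x * y) * z ≈ (x * z) * y
    *-assoc-comm x y z = begin
      (x * y) * z ≈⟨ *-assoc x y z ⟩
      x * (y * z) ≈⟨ *-congˡ (*-comm y z) ⟩
      x * (z * y) ≈⟨ *-assoc x z y ⟨
      (x * z) * y ∎

  ⟨⟩-linearʳ : ∀ {n} (s t u : Vector Carrier n) a b →
               ⟨ s , (λ j → t j * a + u j * b) ⟩ ≈ ⟨ s , t ⟩ * a + ⟨ s , u ⟩ * b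
  ⟨⟩-linearʳ s t u a b = begin
    sum (λ j → s j * (t j * a + u j * b))         ≈⟨ sum-cong-≋ (λ j → distrib-assoc (s j) (t j) (u j)) ⟩
    sum (λ j → (s j * t j) * a + (s j * u j) * b) ≈⟨ ∑-distrib-+ (λ j → (s j * t j) * a) (λ j → (s j * u j) * b) ⟩
    sum (λ j → (s j * t j) * a) + sum (λ j → (s j * u j) * b)
      ≈⟨ +-cong (*-distribʳ-sum a (λ j → s j * t j)) (*-distribʳ-sum b (λ j → s j * u j)) ⟨
    ⟨ s , t ⟩ * a + ⟨ s , u ⟩ * b                  ∎
    where
    distrib-assoc : ∀ x y z → x * (y * a + z * b) ≈ (x * y) * a + (x * z) * b
    distrib-assoc x y z = trans (distribˡ x (y * a) (z * b)) (+-cong (sym (*-assoc x y a)) (sym (*-assoc x z b)))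

  ⟨⟩-removeAt : ∀ {n} (s t : Vector Carrier (suc n)) i →
                ⟨ s , t ⟩ ≈ s i * t i + ⟨ removeAt s i , removeAt t i ⟩
  ⟨⟩-removeAt s t i = sum-remove {i = i} (λ j → s j * t j)

  -- Eliminating the k-th unknown with pivot row u: row t becomes u k · t − t k · u
  -- (without its k-th entry, which is now 0).
  eliminate : ∀ {n} → Vector Carrier (suc n) → Fin (suc n) → Vector Carrier (suc n) → Vector Carrier n
  eliminate u k t j = removeAt t k j * u k + removeAt u k j * - t k

  backSubstitute : ∀ {n} → Vector Carrier (suc n) → Fin (suc n) → Vector Carrier n → Vector Carrier (suc n)
  backSubstitute u k μ = insertAt (λ j → μ j * u k) k (- ⟨ μ , removeAt u k ⟩)

  eliminate-self : ∀ {n} (u : Vector Carrier (suc n)) k j → eliminate u k u j ≈ 0#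
  eliminate-self u k j = begin
    removeAt u k j * u k + removeAt u k j * - u k ≈⟨ distribˡ (removeAt u k j) (u k) (- u k) ⟨
    removeAt u k j * (u k - u k)                  ≈⟨ *-congˡ (-‿inverseʳ (u k)) ⟩
    removeAt u k j * 0#                           ≈⟨ zeroʳ _ ⟩
    0#                                            ∎

  backSubstitute-solves : ∀ {n} (u t : Vector Carrier (suc n)) k (μ : Vector Carrier n) →
                          ⟨ μ , eliminate u k t ⟩ ≈ 0# → ⟨ backSubstitute u k μ , t ⟩ ≈ 0#
  backSubstitute-solves u t k μ μ-solves = begin
    ⟨ backSubstitute u k μ , t ⟩                   ≈⟨ ⟨⟩-removeAt (backSubstitute u k μ) t k ⟩
    backSubstitute u k μ k * t k + ⟨ removeAt (backSubstitute u k μ) k , t′ ⟩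
      ≡⟨ ≡.cong₂ (λ a b → a * t k + b) (insertAt-lookup _ k _) (sum-cong-≗ (λ j → ≡.cong (_* t′ j) (insertAt-punchIn _ k _ j))) ⟩
    - S * t k + ⟨ (λ j → μ j * u k) , t′ ⟩         ≈⟨ +-cong (sym (-‿distribˡ-* S (t k))) (⟨⟩-scaleˡ μ t′ (u k)) ⟩
    - (S * t k) + ⟨ μ , t′ ⟩ * u k                 ≈⟨ +-cong (-‿distribʳ-* S (t k)) refl ⟩
    S * - t k + ⟨ μ , t′ ⟩ * u k                   ≈⟨ +-comm _ _ ⟩
    ⟨ μ , t′ ⟩ * u k + S * - t k                   ≈⟨ ⟨⟩-linearʳ μ t′ (removeAt u k) (u k) (- t k) ⟨
    ⟨ μ , eliminate u k t ⟩                        ≈⟨ μ-solves ⟩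
    0#                                             ∎
    where
    S = ⟨ μ , removeAt u k ⟩
    t′ = removeAt t k

  isolate : ∀ {n} (s t : Vector Carrier (suc n)) i μ → s i * μ ≈ 1# → ⟨ s , t ⟩ ≈ 0# →
            t i ≈ ⟨ (λ k → removeAt s i k * - μ) , removeAt t i ⟩
  isolate s t i μ sᵢμ≈1 s-solves = begin
    t i                    ≈⟨ *-identityʳ (t i) ⟨
    t i * 1#               ≈⟨ *-congˡ sᵢμ≈1 ⟨
    t i * (s i * μ)        ≈⟨ *-assoc (t i) (s i) μ ⟨
    (t i * s i) * μ        ≈⟨ *-congʳ (trans (*-comm (t i) (s i)) sᵢtᵢ≈-Q) ⟩
    - Q * μ                ≈⟨ -‿distribˡ-* Q μ ⟨
    - (Q * μ)              ≈⟨ -‿distribʳ-* Q μ ⟩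
    Q * - μ                ≈⟨ ⟨⟩-scaleˡ (removeAt s i) (removeAt t i) (- μ) ⟨
    ⟨ (λ k → removeAt s i k * - μ) , removeAt t i ⟩ ∎
    where
    Q = ⟨ removeAt s i , removeAt t i ⟩
    sᵢtᵢ≈-Q : s i * t i ≈ - Q
    sᵢtᵢ≈-Q = inverseˡ-unique _ _ (trans (sym (⟨⟩-removeAt s t i)) s-solves)

module HomogeneousSystem {c ℓ} (K : Field c ℓ) where
  open Field K
  open DotProduct commutativeRing
  open import Relation.Binary.Reasoning.Setoid setoid

  *-nonzero : ∀ {x y} → x ≉ 0# → y ≉ 0# → x * y ≉ 0#
  *-nonzero {x} {y} x≉0 y≉0 xy≈0 with inverse x x≉0
  ... | x⁻¹ , xx⁻¹≈1 = y≉0 (begin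
    y              ≈⟨ *-identityˡ y ⟨
    1# * y         ≈⟨ *-congʳ xx⁻¹≈1 ⟨
    (x * x⁻¹) * y  ≈⟨ *-congʳ (*-comm x x⁻¹) ⟩
    (x⁻¹ * x) * y  ≈⟨ *-assoc x⁻¹ x y ⟩
    x⁻¹ * (x * y)  ≈⟨ *-congˡ xy≈0 ⟩
    x⁻¹ * 0#       ≈⟨ zeroʳ x⁻¹ ⟩
    0#             ∎)

  NontrivialSolution : ∀ {m n} → (Fin m → Vector Carrier n) → Set (c ⊔ ℓ)
  NontrivialSolution {n = n} A =
    ∃ λ (s : Vector Carrier n) → (∃ λ j → s j ≉ 0#) × (∀ r → ⟨ s , A r ⟩ ≈ 0#)

  nontrivialSolution : (∀ x → Dec (x ≈ 0#)) →
                       ∀ {m n} → m < n → (A : Fin m → Vector Carrier n) → NontrivialSolution A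
  nontrivialSolution ≈0? {zero} {suc n} _ A = (λ _ → 1#) , (F.zero , λ 1≈0 → 0≉1 (sym 1≈0)) , λ ()
  nontrivialSolution ≈0? {suc m} {suc n} (s≤s m<n) A with all? (λ j → ≈0? (A F.zero j))
  ... | yes row₀≈0 with nontrivialSolution ≈0? (m<n⇒m<1+n m<n) (A ∘ F.suc)
  ...   | s , s≉0 , s-solves = s , s≉0 , λ where
            F.zero    → ⟨⟩-zeroʳ s (A F.zero) row₀≈0
            (F.suc r) → s-solves r
  nontrivialSolution ≈0? {suc m} {suc n} (s≤s m<n) A | no row₀≉0
    with ¬∀⟶∃¬ _ _ (λ j → ≈0? (A F.zero j)) row₀≉0
  ... | k , pivot≉0 with nontrivialSolution ≈0? m<n (λ r → eliminate (A F.zero) k (A (F.suc r)))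
  ...   | μ , (j , μⱼ≉0) , μ-solves =
    backSubstitute (A F.zero) k μ , (punchIn k j , s≉0) , λ where
      F.zero    → backSubstitute-solves (A F.zero) (A F.zero) k μ
                    (⟨⟩-zeroʳ μ _ (eliminate-self (A F.zero) k))
      (F.suc r) → backSubstitute-solves (A F.zero) (A (F.suc r)) k μ (μ-solves r)
    where
    s≉0 : backSubstitute (A F.zero) k μ (punchIn k j) ≉ 0#
    s≉0 = ≡.subst (_≉ 0#) (≡.sym (insertAt-punchIn _ k _ j)) (*-nonzero μⱼ≉0 pivot≉0)

module ExtendedOrder {g ℓ₁ ℓ₂} (Γ : OrderedAbelianGroup g ℓ₁ ℓ₂) where
  open OrderedAbelianGroup Γ
  open Extended Γ
  open import Relation.Binary.Construct.Add.Supremum.Equality _≈_ public using (_≈⁺_; ⊤⁺≈⊤⁺; [_])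
  open import Relation.Binary.Construct.Add.Supremum.NonStrict _≤_ public using (_≤⁺_; [_]; _≤⊤⁺)
  open import Relation.Binary.Construct.Add.Supremum.NonStrict _≤_ using (≤⁺-isTotalOrder)
  open IsTotalOrder isTotalOrder using (total; ≲-respˡ-≈; ≲-respʳ-≈) renaming (trans to ≤-trans)
  open import Algebra.Properties.Group group using (identityˡ-unique)
  open import Data.Unit using (tt)

  -- Defs' _≤∞_ and _≈∞_ are defined by recursion, so their arguments cannot be inferred;
  -- we work with the library's inductive _≤⁺_ and _≈⁺_ on the same type Maybe Carrier.
  module ≤⁺ = IsTotalOrder (≤⁺-isTotalOrder isTotalOrder)

  ≈∞⇒≈⁺ : ∀ u v → u ≈∞ v → u ≈⁺ v
  ≈∞⇒≈⁺ nothing  nothing  _ = ⊤⁺≈⊤⁺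
  ≈∞⇒≈⁺ (just _) (just _) e = [ e ]
  ≈∞⇒≈⁺ nothing  (just _) (lift ())
  ≈∞⇒≈⁺ (just _) nothing  (lift ())

  ≤⁺⇒≤∞ : ∀ {u v} → u ≤⁺ v → u ≤∞ v
  ≤⁺⇒≤∞ [ u≤v ]  = u≤v
  ≤⁺⇒≤∞ (_ ≤⊤⁺) = lift tt

  ∞≤⁺⇒≡∞ : ∀ {u} → ∞ ≤⁺ u → u ≡ ∞
  ∞≤⁺⇒≡∞ (_ ≤⊤⁺) = ≡.refl

  +∞-mono-≤⁺ : ∀ {u v w z} → u ≤⁺ v → w ≤⁺ z → (u +∞ w) ≤⁺ (v +∞ z)
  +∞-mono-≤⁺ [ a≤b ]  [ c≤d ]  = [ ≤-trans (≤-compat _ a≤b) (∙-monoʳ c≤d) ]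
    where
    ∙-monoʳ : ∀ {x y z} → y ≤ z → (x ∙ y) ≤ (x ∙ z)
    ∙-monoʳ {x} {y} {z} y≤z = ≲-respˡ-≈ (comm y x) (≲-respʳ-≈ (comm z x) (≤-compat x y≤z))
  +∞-mono-≤⁺ [ _ ]    (_ ≤⊤⁺) = _ ≤⊤⁺
  +∞-mono-≤⁺ (_ ≤⊤⁺) _        = _ ≤⊤⁺

  idempotent⇒ε : ∀ {u} → u ≢ ∞ → (u +∞ u) ≈⁺ u → u ≈⁺ just ε
  idempotent⇒ε {nothing} u≢∞ _          = contradiction ≡.refl u≢∞
  idempotent⇒ε {just a}  _   [ aa≈a ] = [ identityˡ-unique a a aa≈a ]

  -- an ordered group has no torsion: a ≤ ε would give ε ≈ a ∙ a ≤ a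
  square≈ε⇒ε≤ : ∀ {u} → (u +∞ u) ≈⁺ just ε → just ε ≤⁺ u
  square≈ε⇒ε≤ {nothing} _ = _ ≤⊤⁺
  square≈ε⇒ε≤ {just a}  [ aa≈ε ] with total a ε
  ... | inj₂ ε≤a = [ ε≤a ]
  ... | inj₁ a≤ε = [ ≲-respˡ-≈ aa≈ε (≲-respʳ-≈ (identityˡ a) (≤-compat a a≤ε)) ]

argmin : ∀ {a r} {A : Set a} {_≤_ : Rel A r} → Reflexive _≤_ → Transitive _≤_ → Total _≤_ →
         ∀ {n} (f : Fin (suc n) → A) → ∃ λ i → ∀ j → f i ≤ f j
argmin refl trans total {zero}  f = F.zero , λ { F.zero → refl }
argmin refl trans total {suc n} f with argmin refl trans total (f ∘ F.suc)
... | i , fᵢ-min with total (f F.zero) (f (F.suc i))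
...   | inj₁ f₀≤fᵢ = F.zero , λ { F.zero → refl ; (F.suc j) → trans f₀≤fᵢ (fᵢ-min j) }
...   | inj₂ fᵢ≤f₀ = F.suc i , λ { F.zero → fᵢ≤f₀ ; (F.suc j) → fᵢ-min j }

module Valuation {c ℓ g ℓ₁ ℓ₂} (K : ValuedField c ℓ g ℓ₁ ℓ₂) where
  open ValuedField K
  open ExtendedOrder Γ
  open import Algebra.Properties.Ring ring using (-1*x≈-x; -‿involutive; -‿distribʳ-*)
  module Γ = OrderedAbelianGroup Γ

  ≈0? : ∀ x → Dec (x ≈ 0#)
  ≈0? x with ν x in νx≡
  ... | nothing = yes (ν-∞⇒0 x νx≡)
  ... | just _  = no λ x≈0 → contradiction (≡.trans (≡.sym νx≡) (0⇒ν-∞ x x≈0)) λ ()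

  ν-cong⁺ : ∀ {x y} → x ≈ y → ν x ≈⁺ ν y
  ν-cong⁺ {x} {y} x≈y = ≈∞⇒≈⁺ (ν x) (ν y) (ν-cong x≈y)

  ν-mult⁺ : ∀ x y → ν (x * y) ≈⁺ (ν x +∞ ν y)
  ν-mult⁺ x y = ≈∞⇒≈⁺ (ν (x * y)) (ν x +∞ ν y) (ν-mult x y)

  _∈𝒪 : Carrier → Set (g ⊔ ℓ₂)
  x ∈𝒪 = just Γ.ε ≤⁺ ν x

  ν≤⁺ν-nonzero : ∀ {x y} → ν x ≤⁺ ν y → y ≉ 0# → x ≉ 0#
  ν≤⁺ν-nonzero {x} {y} νx≤νy y≉0 x≈0 =
    y≉0 (ν-∞⇒0 y (∞≤⁺⇒≡∞ (≡.subst (_≤⁺ ν y) (0⇒ν-∞ x x≈0) νx≤νy)))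

  ν1≈ε : ν 1# ≈⁺ just Γ.ε
  ν1≈ε = idempotent⇒ε (λ ν1≡∞ → 0≉1 (sym (ν-∞⇒0 1# ν1≡∞)))
    (≤⁺.Eq.trans (≤⁺.Eq.sym (ν-mult⁺ 1# 1#)) (ν-cong⁺ (*-identityˡ 1#)))

  ∈𝒪-resp : ∀ {x y} → x ≈ y → x ∈𝒪 → y ∈𝒪
  ∈𝒪-resp x≈y x∈𝒪 = ≤⁺.≲-respʳ-≈ (ν-cong⁺ x≈y) x∈𝒪

  ∈𝒪-* : ∀ {x y} → x ∈𝒪 → y ∈𝒪 → (x * y) ∈𝒪
  ∈𝒪-* {x} {y} x∈𝒪 y∈𝒪 =
    ≤⁺.≲-respˡ-≈ [ Γ.identityˡ Γ.ε ] (≤⁺.≲-respʳ-≈ (≤⁺.Eq.sym (ν-mult⁺ x y)) (+∞-mono-≤⁺ x∈𝒪 y∈𝒪))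

  -1∈𝒪 : (- 1#) ∈𝒪
  -1∈𝒪 = square≈ε⇒ε≤ (≤⁺.Eq.trans (≤⁺.Eq.sym (ν-mult⁺ (- 1#) (- 1#))) (≤⁺.Eq.trans (ν-cong⁺ -1*-1≈1) ν1≈ε))
    where
    -1*-1≈1 : - 1# * - 1# ≈ 1#
    -1*-1≈1 = trans (-1*x≈-x (- 1#)) (-‿involutive 1#)

  quotient∈𝒪 : ∀ {a b μ} → a * μ ≈ 1# → ν a ≤⁺ ν b → (b * μ) ∈𝒪
  quotient∈𝒪 {a} {b} {μ} aμ≈1 νa≤νb =
    ≤⁺.≲-respˡ-≈ νa+νμ≈ε (≤⁺.≲-respʳ-≈ (≤⁺.Eq.sym (ν-mult⁺ b μ)) (+∞-mono-≤⁺ νa≤νb ≤⁺.refl))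
    where
    νa+νμ≈ε : (ν a +∞ ν μ) ≈⁺ just Γ.ε
    νa+νμ≈ε = ≤⁺.Eq.trans (≤⁺.Eq.sym (ν-mult⁺ a μ)) (≤⁺.Eq.trans (ν-cong⁺ aμ≈1) ν1≈ε)

  -quotient∈𝒪 : ∀ {a b μ} → a * μ ≈ 1# → ν a ≤⁺ ν b → (b * - μ) ∈𝒪
  -quotient∈𝒪 {a} {b} {μ} aμ≈1 νa≤νb = ∈𝒪-resp -1*bμ≈b*-μ (∈𝒪-* -1∈𝒪 (quotient∈𝒪 aμ≈1 νa≤νb))
    where
    -1*bμ≈b*-μ : - 1# * (b * μ) ≈ b * - μ
    -1*bμ≈b*-μ = trans (-1*x≈-x (b * μ)) (-‿distribʳ-* b μ)

module ConvexHull {c ℓ g ℓ₁ ℓ₂} (K : ValuedField c ℓ g ℓ₁ ℓ₂) where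
  open ValuedField K
  open ExtendedOrder Γ
  open Valuation K
  open DotProduct commutativeRing
  open HomogeneousSystem field'
  open import Relation.Binary.Reasoning.Setoid setoid

  ∑≡sum : ∀ {n} (f : Vector Carrier n) → ∑ f ≡ sum f
  ∑≡sum {zero}  f = ≡.refl
  ∑≡sum {suc n} f = ≡.cong (f F.zero +_) (∑≡sum (f ∘ F.suc))

  OtherPoints : ∀ {d N} → (Fin N → Point d) → Fin N → Point d → Set c
  OtherPoints x i z = ∃ λ j → j ≢ i × z ≡ x j

  homogenize : ∀ {d N} → (Fin N → Point d) → Fin (suc d) → Vector Carrier N
  homogenize x F.zero    j = 1#
  homogenize x (F.suc r) j = x j r

  nontrivialSolution⇒inConv : ∀ {d n} (x : Fin (suc (suc n)) → Point d) →
    NontrivialSolution (homogenize x) → ∃ λ i → InConv (OtherPoints x i) (x i)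
  nontrivialSolution⇒inConv {n = n} x (s , (j , sⱼ≉0) , s-solves)
    with argmin ≤⁺.refl ≤⁺.trans ≤⁺.total (ν ∘ s)
  ... | i , νsᵢ-min with inverse (s i) (ν≤⁺ν-nonzero (νsᵢ-min j) sⱼ≉0)
  ... | μ , sᵢμ≈1 = i , n , removeAt x i , α , others , α∈𝒪 , ∑α≈1 , xᵢ≈∑αy
    where
    α : Vector Carrier (suc n)
    α k = removeAt s i k * - μ

    others : ∀ k → OtherPoints x i (removeAt x i k)
    others k = punchIn i k , punchInᵢ≢i i k , ≡.refl

    α∈𝒪 : ∀ k → InO (α k)
    α∈𝒪 k = ≤⁺⇒≤∞ (-quotient∈𝒪 sᵢμ≈1 (νsᵢ-min (punchIn i k)))

    ∑α≈1 : ∑ α ≈ 1#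
    ∑α≈1 = begin
      ∑ α         ≡⟨ ∑≡sum α ⟩
      sum α       ≈⟨ sum-cong-≋ (λ k → *-identityʳ (α k)) ⟨
      ⟨ α , removeAt (homogenize x F.zero) i ⟩ ≈⟨ isolate s (homogenize x F.zero) i μ sᵢμ≈1 (s-solves F.zero) ⟨
      1#          ∎

    xᵢ≈∑αy : ∀ r → x i r ≈ ∑ (λ k → α k * removeAt x i k r)
    xᵢ≈∑αy r = trans (isolate s (homogenize x (F.suc r)) i μ sᵢμ≈1 (s-solves (F.suc r)))
                     (reflexive (≡.sym (∑≡sum (λ k → α k * removeAt x i k r))))

  convexHullOfOthers : ∀ d (x : Fin (suc (suc d)) → Point d) → ∃ λ i → InConv (OtherPoints x i) (x i)
  convexHullOfOthers d x = nontrivialSolution⇒inConv x (nontrivialSolution ≈0? (n<1+n (suc d)) (homogenize x))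

open import Data.Nat using (_+_; _≤_)

proposition2p8 : ∀ {c ℓ g ℓ₁ ℓ₂ : Level} (K : ValuedField c ℓ g ℓ₁ ℓ₂) (d : ℕ) → 1 ≤ d →
    (x : Fin (d + 2) → ValuedField.Point K d) →
    ∃ λ (i : Fin (d + 2)) →
      ValuedField.InConv K (λ z → ∃ λ (j : Fin (d + 2)) → j ≢ i × z ≡ x j) (x i)
proposition2p8 K d _ rewrite ℕ.+-comm d 2 = ConvexHull.convexHullOfOthers K d
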